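{- There exist a constant $\kappa > 0$ and a threshold $N$ such that for all integers $n, d \geq N$, every branching program computing $\mathrm{OV}_{n,d}$ has size at least $$\kappa \cdot \frac{\min\{n^2,\ n \cdot 2^d/d^{1/2}\}}{\log(nd)\,\log(d)}.$$ (Equivalently: for all sufficiently large $n,d$, $\mathrm{OV}_{n,d}$ does not have branching programs of size $O(\min\{n^2, n2^d/d^{1/2}\}/(\log(nd)\log d))$.)
   Context: The Orthogonal Vectors function $\mathrm{OV}_{n,d}:\{0,1\}^{nd}\to\{0,1\}$ takes $n$ vectors $v_1,\ldots,v_n \in \{0,1\}^d$ (given as $nd$ Boolean input variables) and outputs $1$ iff there exist $i,j$ with $\langle v_i,v_j\rangle = 0$ over the integers. A branching program of size $S$ on variables $x_1,\ldots,x_m$ is a directed acyclic graph on $S$ nodes with a distinguished start node and exactly two sink nodes labeled $0$ and $1$; every non-sink node is labeled by a variable $x_i$ and has two outgoing edges labeled $x_i=0$ and $x_i=1$. On input $a\in\{0,1\}^m$, one follows from the start node the edges consistent with $a$; the label of the sink reached is the output. -}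

module Defs where

open import Data.Bool using (Bool; true; false; if_then_else_)
open import Data.Nat using (ℕ; zero; suc; _+_; _*_; _<_)
open import Data.Fin using (Fin; toℕ; combine)
import Data.Fin as F
open import Data.Fin.Properties using (any?)
open import Data.Maybe using (Maybe; just; nothing)
open import Data.Product using (_×_)
open import Relation.Binary.PropositionalEquality using (_≡_)
open import Relation.Nullary.Decidable using (⌊_⌋)
import Data.Nat.Properties as NP

data Node (m S : ℕ) : Set where
  leaf  : Bool → Node m S
  query : Fin m → Fin S → Fin S → Node m S

-- Acyclicity is expressed by a topological numbering:
-- every edge goes from a smaller to a larger node index (any DAG admits one).
record BP (m S : ℕ) : Set where
  field
    start   : Fin S
    kind    : Fin S → Node m S
    sink    : Bool → Fin S
    sink-ok : ∀ b → kind (sink b) ≡ leaf b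
    sinks-only : ∀ i b → kind i ≡ leaf b → i ≡ sink b
    acyclic : ∀ i x j k → kind i ≡ query x j k → (toℕ i < toℕ j) × (toℕ i < toℕ k)

run : ∀ {m S} → BP m S → (Fin m → Bool) → ℕ → Fin S → Maybe Bool
run P a zero i = nothing
run P a (suc f) i with BP.kind P i
... | leaf b = just b
... | query x j k = run P a f (if a x then k else j)

-- P computes g: on every input, the path from the start node reaches the sink
-- labeled g(a).  (Fuel S suffices since paths in an S-node DAG visit ≤ S nodes.)
Computes : ∀ {m S} → BP m S → ((Fin m → Bool) → Bool) → Set
Computes {m} {S} P g = ∀ (a : Fin m → Bool) → run P a S (BP.start P) ≡ just (g a)

bit : Bool → ℕ
bit true = 1
bit false = 0

inner : ∀ {d} → (Fin d → Bool) → (Fin d → Bool) → ℕ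
inner {zero} u v = 0
inner {suc d} u v = bit (u F.zero) * bit (v F.zero) + inner (λ k → u (F.suc k)) (λ k → v (F.suc k))

vecOf : ∀ {n d} → (Fin (n * d) → Bool) → Fin n → Fin d → Bool
vecOf a i k = a (combine i k)

OV : (n d : ℕ) → (Fin (n * d) → Bool) → Bool
OV n d a = ⌊ any? (λ i → any? (λ j → inner (vecOf {n} {d} a i) (vecOf {n} {d} a j) NP.≟ 0)) ⌋

-- Nechiporuk's method.  Let s_i be the number of nodes of the program that query the i-th
-- vector.  As a function of the variables outside block i, the behaviour of the program on
-- block i is determined by where the paths from the start node and from the 2 s_i successors
-- of those nodes first reach a sink or a node querying block i; so at most (S+1)^(1+2 s_i)
-- subfunctions of block i occur.  Write d ∈ {2m+1, 2m+2} and K = ⌊min(n, C(2m,m))/2⌋, and code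
-- the pairs (t, c) ∈ K × 2 injectively by m-subsets u of {1..2m}.  Storing a string T ∈ 2^K in
-- the blocks j ≠ i as element vectors (1, u, 0, …) of the codes of (t, T t), the complement
-- vector (0, ¬u, 0, …) of the code of (t, c) put into block i is orthogonal to one of them iff
-- T t = c, and no other pair of vectors is orthogonal.  So OV has 2^K subfunctions on every
-- block, K ≤ (1 + 2 s_i) log(S+1), and a block with n s_i ≤ S yields
-- n·min(n, C(2m,m)) = O(S log(nd)); since C(2m,m)² ≥ 16^m / (4m+1), this is the bound.

module Submission where

open import Defs
open import Data.Bool using (Bool; true; false; not; _∧_; if_then_else_)
open import Data.Empty using (⊥-elim)
open import Data.Fin using (Fin; toℕ; fromℕ<; inject≤; combine; remQuot; quotient; splitAt; join; funToFin; finToFun)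
import Data.Fin as F
import Data.Fin.Properties as FP
open import Data.List using (List; []; _∷_; length; filter; allFin)
import Data.List as List
import Data.List.Properties as LP
open import Data.List.Membership.Propositional using (_∈_)
open import Data.List.Membership.Propositional.Properties using (∈-filter⁺; ∈-allFin)
open import Data.List.Relation.Unary.Any using (index)
open import Data.List.Relation.Unary.Any.Properties using (lookup-index)
open import Data.Maybe using (Maybe; just; nothing; fromMaybe; maybe′)
open import Data.Maybe.Properties using (just-injective)
open import Data.Nat
  using (ℕ; zero; suc; _+_; _*_; _^_; _∸_; _%_; _≤_; _<_; _⊓_; z≤n; s≤s; ⌊_/2⌋; ⌈_/2⌉; NonZero; >-nonZero; >-nonZero⁻¹)
open import Data.Nat.DivMod using (m%n<n; m<n⇒m%n≡m; [m+n]%n≡m%n)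
open import Data.Nat.Induction using (<-rec)
open import Data.Nat.Logarithm using (⌈log₂_⌉; ⌈log₂⌉-mono-≤; ⌈log₂2^n⌉≡n; ⌈log₂⌈n/2⌉⌉≡⌈log₂n⌉∸1)
open import Data.Nat.Properties
open import Algebra.Properties.CommutativeMonoid.Sum +-0-commutativeMonoid
  using (sum; sum-syntax; sum-cong-≗; ∑-distrib-+; sum-replicate-zero)
open import Data.Nat.Tactic.RingSolver using (solve-∀)
open import Data.Product using (Σ; ∃; ∃₂; _×_; _,_; proj₁; proj₂; uncurry)
open import Data.Sum using (_⊎_; inj₁; inj₂)
open import Data.Vec using (Vec; []; _∷_; lookup; replicate; tail)
import Data.Vec.Functional as VF
open import Function using (_∘_; id; case_of_)
open import Relation.Binary.PropositionalEquality
open import Relation.Nullary using (Dec; yes; no; does)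
open import Relation.Nullary.Negation using (contradiction)
open import Relation.Unary using (Decidable)

-- Inner products and vectors of fixed weight

disjoint⇒inner≡0 : ∀ {d} (u v : Fin d → Bool) → (∀ k → u k ∧ v k ≡ false) → inner u v ≡ 0
disjoint⇒inner≡0 {zero} u v _ = refl
disjoint⇒inner≡0 {suc d} u v disj with u F.zero | v F.zero | disj F.zero
... | false | _     | _ = disjoint⇒inner≡0 (VF.tail u) (VF.tail v) (disj ∘ F.suc)
... | true  | false | _ = disjoint⇒inner≡0 (VF.tail u) (VF.tail v) (disj ∘ F.suc)

common⇒inner≢0 : ∀ {d} (u v : Fin d → Bool) k → u k ≡ true → v k ≡ true → inner u v ≢ 0
common⇒inner≢0 u v F.zero uk vk rewrite uk | vk = λ ()
common⇒inner≢0 u v (F.suc k) uk vk eq =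
  common⇒inner≢0 (VF.tail u) (VF.tail v) k uk vk (m+n≡0⇒n≡0 (bit (u F.zero) * bit (v F.zero)) eq)

weight : ∀ {L} → Vec Bool L → ℕ
weight []       = 0
weight (b ∷ bs) = bit b + weight bs

weight<⇒∃false : ∀ {L} (u : Vec Bool L) → weight u < L → ∃ λ j → lookup u j ≡ false
weight<⇒∃false (false ∷ u) _         = F.zero , refl
weight<⇒∃false (true ∷ u)  (s≤s w<L) = let j , uj = weight<⇒∃false u w<L in F.suc j , uj

weight≤∧≢⇒∃false-true : ∀ {L} (u u′ : Vec Bool L) → weight u ≤ weight u′ → u ≢ u′ →
                        ∃ λ j → lookup u j ≡ false × lookup u′ j ≡ true
weight≤∧≢⇒∃false-true [] [] _ u≢u′ = ⊥-elim (u≢u′ refl)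
weight≤∧≢⇒∃false-true (false ∷ u) (true ∷ u′) _ _ = F.zero , refl , refl
weight≤∧≢⇒∃false-true (false ∷ u) (false ∷ u′) w≤w′ u≢u′ =
  let j , uj , u′j = weight≤∧≢⇒∃false-true u u′ w≤w′ (u≢u′ ∘ cong (false ∷_)) in F.suc j , uj , u′j
weight≤∧≢⇒∃false-true (true ∷ u) (true ∷ u′) (s≤s w≤w′) u≢u′ =
  let j , uj , u′j = weight≤∧≢⇒∃false-true u u′ w≤w′ (u≢u′ ∘ cong (true ∷_)) in F.suc j , uj , u′j
weight≤∧≢⇒∃false-true (true ∷ u) (false ∷ u′) w<w′ _ =
  let j , uj , u′j = weight≤∧≢⇒∃false-true u u′ (≤-trans (n≤1+n _) w<w′) (<⇒≢ w<w′ ∘ cong weight)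
  in F.suc j , uj , u′j

binomial : ℕ → ℕ → ℕ
binomial n       zero    = 1
binomial zero    (suc k) = 0
binomial (suc n) (suc k) = binomial n k + binomial n (suc k)

mutual
  ofWeight : ∀ n k → Fin (binomial n k) → Vec Bool n
  ofWeight n       zero    _ = replicate n false
  ofWeight (suc n) (suc k) i = ofWeight-split n k (splitAt (binomial n k) i)

  ofWeight-split : ∀ n k → Fin (binomial n k) ⊎ Fin (binomial n (suc k)) → Vec Bool (suc n)
  ofWeight-split n k (inj₁ i) = true  ∷ ofWeight n k i
  ofWeight-split n k (inj₂ i) = false ∷ ofWeight n (suc k) i

weight-replicate-false : ∀ n → weight (replicate n false) ≡ 0
weight-replicate-false zero    = refl
weight-replicate-false (suc n) = weight-replicate-false n

mutual
  weight-ofWeight : ∀ n k i → weight (ofWeight n k i) ≡ k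
  weight-ofWeight n       zero    _ = weight-replicate-false n
  weight-ofWeight (suc n) (suc k) i = weight-ofWeight-split n k (splitAt (binomial n k) i)

  weight-ofWeight-split : ∀ n k i → weight (ofWeight-split n k i) ≡ suc k
  weight-ofWeight-split n k (inj₁ i) = cong suc (weight-ofWeight n k i)
  weight-ofWeight-split n k (inj₂ i) = weight-ofWeight n (suc k) i

mutual
  ofWeight-injective : ∀ n k {i j} → ofWeight n k i ≡ ofWeight n k j → i ≡ j
  ofWeight-injective n       zero    {F.zero} {F.zero} _ = refl
  ofWeight-injective (suc n) (suc k) {i} {j} eq = begin
    i                                      ≡⟨ FP.join-splitAt (binomial n k) _ i ⟨
    join _ _ (splitAt (binomial n k) i)    ≡⟨ cong (join _ _) (ofWeight-split-injective n k eq) ⟩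
    join _ _ (splitAt (binomial n k) j)    ≡⟨ FP.join-splitAt (binomial n k) _ j ⟩
    j                                      ∎
    where open ≡-Reasoning

  ofWeight-split-injective : ∀ n k {i j} → ofWeight-split n k i ≡ ofWeight-split n k j → i ≡ j
  ofWeight-split-injective n k {inj₁ i} {inj₁ j} eq = cong inj₁ (ofWeight-injective n k (cong tail eq))
  ofWeight-split-injective n k {inj₂ i} {inj₂ j} eq = cong inj₂ (ofWeight-injective n (suc k) (cong tail eq))

-- Central binomial coefficients

binomial-n-1 : ∀ n → binomial n 1 ≡ n
binomial-n-1 zero    = refl
binomial-n-1 (suc n) = cong suc (binomial-n-1 n)

binomial-absorption : ∀ n k → suc k * binomial (suc n) (suc k) ≡ suc n * binomial n k
binomial-absorption zero    zero    = refl
binomial-absorption zero    (suc k) = *-zeroʳ (suc (suc k))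
binomial-absorption (suc n) zero    = trans (+-identityʳ _) (trans (cong suc (binomial-n-1 (suc n))) (sym (*-identityʳ _)))
binomial-absorption (suc n) (suc k) = begin
  suc (suc k) * (a + b)                ≡⟨ distrib k a b ⟩
  suc k * a + a + suc (suc k) * b      ≡⟨ cong₂ (λ x y → x + a + y) (binomial-absorption n k) (binomial-absorption n (suc k)) ⟩
  suc n * c + a + suc n * e            ≡⟨ regroup (suc n) c e a ⟩
  suc n * (c + e) + a                  ≡⟨ +-comm (suc n * a) a ⟩
  suc (suc n) * a                      ∎
  where
  open ≡-Reasoning
  a b c e : ℕ
  a = binomial (suc n) (suc k)
  b = binomial (suc n) (suc (suc k))
  c = binomial n k
  e = binomial n (suc k)
  distrib : ∀ k a b → suc (suc k) * (a + b) ≡ suc k * a + a + suc (suc k) * b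
  distrib = solve-∀
  regroup : ∀ x c e a → x * c + a + x * e ≡ x * (c + e) + a
  regroup = solve-∀

double : ℕ → ℕ
double zero    = zero
double (suc m) = suc (suc (double m))

double≡+ : ∀ m → double m ≡ m + m
double≡+ zero    = refl
double≡+ (suc m) = cong suc (trans (cong suc (double≡+ m)) (sym (+-suc m m)))

centralBinomial : ℕ → ℕ
centralBinomial m = binomial (double m) m

centralBinomial-ratio : ∀ m → suc m * centralBinomial (suc m) ≡ 2 * suc (double m) * centralBinomial m
centralBinomial-ratio zero     = refl
centralBinomial-ratio (suc m′) = *-cancelˡ-≡ _ _ (suc m) (begin
  suc m * (suc m * centralBinomial (suc m))  ≡⟨ cong (suc m *_) (binomial-absorption (suc D) m) ⟩
  suc m * (suc (suc D) * binomial (suc D) m) ≡⟨ swap (suc m) (suc (suc D)) (binomial (suc D) m) ⟩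
  suc (suc D) * (suc m * binomial (suc D) m) ≡⟨ cong (suc (suc D) *_) pascal ⟩
  suc (suc D) * (m * c + suc m * c)          ≡⟨ cong (λ D → suc (suc D) * (m * c + suc m * c)) (double≡+ m) ⟩
  suc (suc (m + m)) * (m * c + suc m * c)    ≡⟨ collect m′ c ⟩
  suc m * (2 * suc (m + m) * c)              ≡⟨ cong (λ D → suc m * (2 * suc D * c)) (double≡+ m) ⟨
  suc m * (2 * suc D * c)                    ∎)
  where
  open ≡-Reasoning
  m D c : ℕ
  m = suc m′
  D = double m
  c = centralBinomial m
  symmetry : m * c ≡ suc m * binomial D m′
  symmetry = +-cancelʳ-≡ (m * binomial D m′) _ _ (begin
    m * c + m * binomial D m′         ≡⟨ trans (*-distribˡ-+ m (binomial D m′) c) (+-comm _ (m * c)) ⟨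
    m * binomial (suc D) m            ≡⟨ binomial-absorption D m′ ⟩
    suc D * binomial D m′             ≡⟨ cong (λ x → suc x * binomial D m′) (double≡+ m) ⟩
    suc (m + m) * binomial D m′       ≡⟨ split m′ (binomial D m′) ⟩
    suc m * binomial D m′ + m * binomial D m′ ∎)
    where
    split : ∀ x y → suc (suc x + suc x) * y ≡ suc (suc x) * y + suc x * y
    split = solve-∀
  pascal : suc m * binomial (suc D) m ≡ m * c + suc m * c
  pascal = trans (*-distribˡ-+ (suc m) (binomial D m′) c) (cong (_+ suc m * c) (sym symmetry))
  swap : ∀ x y z → x * (y * z) ≡ y * (x * z)
  swap = solve-∀
  collect : ∀ m c → suc (suc (suc m + suc m)) * (suc m * c + suc (suc m) * c)
                    ≡ suc (suc m) * (2 * suc (suc m + suc m) * c)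
  collect = solve-∀

16^m≤[4m+1]*centralBinomial² : ∀ m → 16 ^ m ≤ (4 * m + 1) * (centralBinomial m * centralBinomial m)
16^m≤[4m+1]*centralBinomial² zero    = s≤s z≤n
16^m≤[4m+1]*centralBinomial² (suc m) = *-cancelˡ-≤ (suc m * suc m) (begin
  suc m * suc m * (16 * 16 ^ m)                      ≡⟨ reassoc₁ (suc m) (16 ^ m) ⟩
  16 * (suc m * suc m) * 16 ^ m                      ≤⟨ *-monoʳ-≤ (16 * (suc m * suc m)) (16^m≤[4m+1]*centralBinomial² m) ⟩
  16 * (suc m * suc m) * ((4 * m + 1) * (c * c))     ≤⟨ slack m c ⟩
  (4 * m + 5) * ((2 * suc (m + m) * c) * (2 * suc (m + m) * c)) ≡⟨ cong (λ D → (4 * m + 5) * ((2 * suc D * c) * (2 * suc D * c))) (double≡+ m) ⟨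
  (4 * m + 5) * ((2 * suc D * c) * (2 * suc D * c))  ≡⟨ cong (λ z → (4 * m + 5) * (z * z)) (centralBinomial-ratio m) ⟨
  (4 * m + 5) * ((suc m * c′) * (suc m * c′))        ≡⟨ reassoc₂ m c′ ⟩
  suc m * suc m * ((4 * suc m + 1) * (c′ * c′))      ∎)
  where
  open ≤-Reasoning
  c c′ D : ℕ
  c = centralBinomial m
  c′ = centralBinomial (suc m)
  D = double m
  reassoc₁ : ∀ x y → x * x * (16 * y) ≡ 16 * (x * x) * y
  reassoc₁ = solve-∀
  slack : ∀ m c → 16 * (suc m * suc m) * ((4 * m + 1) * (c * c))
               ≤ (4 * m + 5) * ((2 * suc (m + m) * c) * (2 * suc (m + m) * c))
  slack m c = begin
    16 * (suc m * suc m) * ((4 * m + 1) * (c * c))   ≡⟨ reassoc m c ⟩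
    16 * (suc m * suc m) * (4 * m + 1) * (c * c)     ≤⟨ *-monoˡ-≤ (c * c) (m≤m+n (16 * (suc m * suc m) * (4 * m + 1)) 4) ⟩
    (16 * (suc m * suc m) * (4 * m + 1) + 4) * (c * c) ≡⟨ poly m c ⟩
    (4 * m + 5) * ((2 * suc (m + m) * c) * (2 * suc (m + m) * c)) ∎
    where
    reassoc : ∀ m c → 16 * (suc m * suc m) * ((4 * m + 1) * (c * c)) ≡ 16 * (suc m * suc m) * (4 * m + 1) * (c * c)
    reassoc = solve-∀
    poly : ∀ m c → (16 * (suc m * suc m) * (4 * m + 1) + 4) * (c * c)
                   ≡ (4 * m + 5) * ((2 * suc (m + m) * c) * (2 * suc (m + m) * c))
    poly = solve-∀
  reassoc₂ : ∀ m c → (4 * m + 5) * ((suc m * c) * (suc m * c)) ≡ suc m * suc m * ((4 * suc m + 1) * (c * c))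
  reassoc₂ = solve-∀

inner-cong : ∀ {d} {u u′ v v′ : Fin d → Bool} → (∀ k → u k ≡ u′ k) → (∀ k → v k ≡ v′ k) →
             inner u v ≡ inner u′ v′
inner-cong {zero}  _   _   = refl
inner-cong {suc d} u≗u′ v≗v′ =
  cong₂ _+_ (cong₂ (λ a b → bit a * bit b) (u≗u′ F.zero) (v≗v′ F.zero))
            (inner-cong (u≗u′ ∘ F.suc) (v≗v′ ∘ F.suc))

inner-comm : ∀ {d} (u v : Fin d → Bool) → inner u v ≡ inner v u
inner-comm {zero}  u v = refl
inner-comm {suc d} u v = cong₂ _+_ (*-comm (bit (u F.zero)) (bit (v F.zero))) (inner-comm (u ∘ F.suc) (v ∘ F.suc))

fromVectors : ∀ {n d} → (Fin n → Fin d → Bool) → Fin (n * d) → Bool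
fromVectors {n} {d} V = uncurry V ∘ remQuot {n} d

vecOf-fromVectors : ∀ {n d} (V : Fin n → Fin d → Bool) i k → vecOf {n} {d} (fromVectors V) i k ≡ V i k
vecOf-fromVectors {n} {d} V i k = cong (uncurry V) (FP.remQuot-combine {n} {d} i k)

module _ {n d : ℕ} (V : Fin n → Fin d → Bool) where

  private
    ovPair? : Dec (∃ λ i → ∃ λ j → inner (vecOf {n} {d} (fromVectors V) i) (vecOf {n} {d} (fromVectors V) j) ≡ 0)
    ovPair? = FP.any? (λ i → FP.any? (λ j → inner (vecOf {n} {d} (fromVectors V) i) (vecOf {n} {d} (fromVectors V) j) ≟ 0))

    inner-vecOf : ∀ i j → inner (vecOf {n} {d} (fromVectors V) i) (vecOf {n} {d} (fromVectors V) j) ≡ inner (V i) (V j)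
    inner-vecOf i j = inner-cong (vecOf-fromVectors V i) (vecOf-fromVectors V j)

  OV-fromVectors≡true : ∀ i j → inner (V i) (V j) ≡ 0 → OV n d (fromVectors V) ≡ true
  OV-fromVectors≡true i j ⟂ with ovPair?
  ... | yes _ = refl
  ... | no ∄ = contradiction (i , j , trans (inner-vecOf i j) ⟂) ∄

  OV-fromVectors≡false : (∀ i j → inner (V i) (V j) ≢ 0) → OV n d (fromVectors V) ≡ false
  OV-fromVectors≡false ∄ with ovPair?
  ... | yes (i , j , ⟂) = contradiction (trans (sym (inner-vecOf i j)) ⟂) (∄ i j)
  ... | no _ = refl

-- Element and complement vectors

entryAt : ∀ {L} → Vec Bool L → ℕ → Maybe Bool
entryAt []       _       = nothing
entryAt (b ∷ _)  zero    = just b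
entryAt (_ ∷ bs) (suc j) = entryAt bs j

entryAt-toℕ : ∀ {L} (u : Vec Bool L) j → entryAt u (toℕ j) ≡ just (lookup u j)
entryAt-toℕ (b ∷ _)  F.zero    = refl
entryAt-toℕ (_ ∷ bs) (F.suc j) = entryAt-toℕ bs j

elementAt complementAt : ∀ {L} → Vec Bool L → ℕ → Bool
elementAt    u zero    = true
elementAt    u (suc j) = fromMaybe false (entryAt u j)
complementAt u zero    = false
complementAt u (suc j) = maybe′ not false (entryAt u j)

element complement : ∀ {L d} → Vec Bool L → Fin d → Bool
element    u = elementAt u ∘ toℕ
complement u = complementAt u ∘ toℕ

complement∧element≡false : ∀ {L} (u : Vec Bool L) j → complementAt u j ∧ elementAt u j ≡ false
complement∧element≡false u zero = refl
complement∧element≡false u (suc j) with entryAt u j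
... | nothing    = refl
... | just true  = refl
... | just false = refl

inner-complement-element≡0 : ∀ {L d} (u : Vec Bool L) → inner {d} (complement u) (element u) ≡ 0
inner-complement-element≡0 {d = d} u = disjoint⇒inner≡0 {d} (complement u) (element u) (complement∧element≡false u ∘ toℕ)

module _ {L d : ℕ} (L<d : L < d) where

  private
    origin : Fin d
    origin = inject≤ F.zero L<d

    shift : Fin L → Fin d
    shift j = inject≤ (F.suc j) L<d

    element-shift : ∀ (u : Vec Bool L) j → element u (shift j) ≡ lookup u j
    element-shift u j = trans (cong (elementAt u) (FP.toℕ-inject≤ (F.suc j) L<d)) (cong (fromMaybe false) (entryAt-toℕ u j))

    complement-shift : ∀ (u : Vec Bool L) j → complement u (shift j) ≡ not (lookup u j)
    complement-shift u j = trans (cong (complementAt u) (FP.toℕ-inject≤ (F.suc j) L<d)) (cong (maybe′ not false) (entryAt-toℕ u j))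

    element-origin : ∀ (u : Vec Bool L) → element u origin ≡ true
    element-origin u = cong (elementAt u) (FP.toℕ-inject≤ F.zero L<d)

  inner-element-element≢0 : ∀ (u u′ : Vec Bool L) → inner {d} (element u) (element u′) ≢ 0
  inner-element-element≢0 u u′ = common⇒inner≢0 _ _ origin (element-origin u) (element-origin u′)

  inner-complement-complement≢0 : ∀ (u : Vec Bool L) → weight u < L → inner {d} (complement u) (complement u) ≢ 0
  inner-complement-complement≢0 u w<L =
    let j , uj≡0 = weight<⇒∃false u w<L
        ¬uj = trans (complement-shift u j) (cong not uj≡0)
    in common⇒inner≢0 _ _ (shift j) ¬uj ¬uj

  inner-complement-element≢0 : ∀ (u u′ : Vec Bool L) → weight u ≡ weight u′ → u ≢ u′ →
                               inner {d} (complement u) (element u′) ≢ 0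
  inner-complement-element≢0 u u′ w≡w′ u≢u′ =
    let j , uj≡0 , u′j≡1 = weight≤∧≢⇒∃false-true u u′ (≤-reflexive w≡w′) u≢u′
    in common⇒inner≢0 _ _ (shift j) (trans (complement-shift u j) (cong not uj≡0)) (trans (element-shift u′ j) u′j≡1)

-- Exits and traces of a branching program

maybeToFin : ∀ {S} → Maybe (Fin S) → Fin (suc S)
maybeToFin = maybe′ F.suc F.zero

maybeToFin-injective : ∀ {S} {a b : Maybe (Fin S)} → maybeToFin a ≡ maybeToFin b → a ≡ b
maybeToFin-injective {a = nothing} {nothing} _  = refl
maybeToFin-injective {a = just _}  {just _}  eq = cong just (FP.suc-injective eq)

funToFin-cong : ∀ {k n} {f g : Fin k → Fin n} → (∀ i → f i ≡ g i) → funToFin f ≡ funToFin g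
funToFin-cong {zero}  _   = refl
funToFin-cong {suc k} f≗g = cong₂ combine (f≗g F.zero) (funToFin-cong (f≗g ∘ F.suc))

funToFin-injective : ∀ {k n} {f g : Fin k → Fin n} → funToFin f ≡ funToFin g → ∀ i → f i ≡ g i
funToFin-injective {f = f} {g} eq i =
  trans (sym (FP.finToFun-funToFin f i)) (trans (cong (λ a → finToFun a i) eq) (FP.finToFun-funToFin g i))


module Exits {m S : ℕ} (P : BP m S) (inside : Fin m → Bool) where
  open BP P

  exit : (Fin m → Bool) → ℕ → Fin S → Maybe (Fin S)
  exit x zero    u = nothing
  exit x (suc f) u with kind u
  ... | leaf _      = just u
  ... | query v j k = if inside v then just u else exit x f (if x v then k else j)

  child : Fin S → Bool → Fin S
  child u c with kind u
  ... | leaf _      = u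
  ... | query _ j k = if c then k else j

  IsExit : Fin S → Set
  IsExit w = (∃ λ b → kind w ≡ leaf b) ⊎ (∃₂ λ v j → ∃ λ k → kind w ≡ query v j k × inside v ≡ true)

  run-leaf : ∀ x f {u b} → kind u ≡ leaf b → run P x (suc f) u ≡ just b
  run-leaf x f {u} eq with kind u
  run-leaf x f refl | _ = refl

  run-query : ∀ x f {u v j k} → kind u ≡ query v j k → run P x (suc f) u ≡ run P x f (if x v then k else j)
  run-query x f {u} eq with kind u
  run-query x f refl | _ = refl

  child-query : ∀ {u v j k} c → kind u ≡ query v j k → child u c ≡ (if c then k else j)
  child-query {u} c eq with kind u
  child-query c refl | _ = refl

  run-mono : ∀ x {f g u c} → f ≤ g → run P x f u ≡ just c → run P x g u ≡ just c
  run-mono x {suc f} {suc g} {u} (s≤s f≤g) eq with kind u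
  ... | leaf _      = eq
  ... | query _ _ _ = run-mono x f≤g eq

  exit-mono : ∀ x {f g u w} → f ≤ g → exit x f u ≡ just w → exit x g u ≡ just w
  exit-mono x {suc f} {suc g} {u} (s≤s f≤g) eq with kind u
  ... | leaf _      = eq
  ... | query v _ _ with inside v
  ...   | true  = eq
  ...   | false = exit-mono x f≤g eq

  run-functional : ∀ x {f g u c c′} → run P x f u ≡ just c → run P x g u ≡ just c′ → c ≡ c′
  run-functional x {f} {g} r r′ =
    just-injective (trans (sym (run-mono x (m≤m+n f g) r)) (run-mono x (m≤n+m g f) r′))

  exit-cong-outside : ∀ {x y} → (∀ v → inside v ≡ false → x v ≡ y v) → ∀ f u → exit x f u ≡ exit y f u
  exit-cong-outside x≈y zero    u = refl
  exit-cong-outside x≈y (suc f) u with kind u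
  ... | leaf _      = refl
  ... | query v j k with inside v in out
  ...   | true  = refl
  ...   | false rewrite x≈y v out = exit-cong-outside x≈y f _

  run⇒exit : ∀ x f u {c} → run P x f u ≡ just c →
             ∃₂ λ w f′ → f′ ≤ f × exit x f u ≡ just w × run P x f′ w ≡ just c × IsExit w
  run⇒exit x (suc f) u r with kind u in eq
  ... | leaf b = u , suc f , ≤-refl , refl , trans (run-leaf x f eq) r , inj₁ (b , eq)
  ... | query v j k with inside v in ins
  ...   | true  = u , suc f , ≤-refl , refl , trans (run-query x f eq) r , inj₂ (v , j , k , eq , ins)
  ...   | false = let w , f′ , f′≤f , e , r′ , isExit = run⇒exit x f _ r
                  in w , f′ , m≤n⇒m≤1+n f′≤f , e , r′ , isExit

  exit⇒run : ∀ x f u {w g c} → exit x f u ≡ just w → run P x g w ≡ just c → ∃ λ g′ → run P x g′ u ≡ just c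
  exit⇒run x (suc f) u {g = g} e r with kind u in eq
  ... | leaf _ rewrite just-injective e = g , r
  ... | query v j k with inside v
  ...   | true rewrite just-injective e = g , r
  ...   | false = let g′ , r′ = exit⇒run x f _ {g = g} e r in suc g′ , trans (run-query x g′ eq) r′

  run-leaf-irrelevant : ∀ x y {f w b c} → kind w ≡ leaf b → run P x f w ≡ just c → run P y f w ≡ just c
  run-leaf-irrelevant x y {suc f} eq r = trans (run-leaf y f eq) (trans (sym (run-leaf x f eq)) r)

  module _ {x y : Fin m → Bool}
    (agree : ∀ {w v j k} → kind w ≡ query v j k → inside v ≡ true → x v ≡ y v)
    (exits-agree : ∀ {w v j k} → kind w ≡ query v j k → inside v ≡ true →
                   ∀ c → exit x S (child w c) ≡ exit y S (child w c))
    where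

    Transfers : ℕ → Set
    Transfers f = ∀ u {c} → f ≤ S → exit x S u ≡ exit y S u → run P x f u ≡ just c →
                  ∃ λ g → run P y g u ≡ just c

    run-transfer : ∀ f → Transfers f
    run-transfer = <-rec Transfers step
      where
      step : ∀ f → (∀ {f′} → f′ < f → Transfers f′) → Transfers f
      step f transfer u {c} f≤S same r with run⇒exit x f u r
      ... | w , f′ , f′≤f , e , r′ , isExit = via isExit f′ f′≤f r′
        where
        e′ : exit y S u ≡ just w
        e′ = trans (sym same) (exit-mono x f≤S e)
        via : IsExit w → ∀ f′ → f′ ≤ f → run P x f′ w ≡ just c → ∃ λ g → run P y g u ≡ just c
        via (inj₁ (_ , eq)) f′ _ r′ = exit⇒run y S u {g = f′} e′ (run-leaf-irrelevant x y {f = f′} eq r′)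
        via (inj₂ (v , j , k , eq , ins)) (suc f″) f′≤f r′ =
          let r″ = subst (λ z → run P x f″ z ≡ just c) (sym (child-query (x v) eq)) (trans (sym (run-query x f″ eq)) r′)
              f″<f = ≤-trans (s≤s ≤-refl) f′≤f
              g , rʸ = transfer f″<f (child w (x v)) (≤-trans (<⇒≤ f″<f) f≤S) (exits-agree eq ins (x v)) r″
              rʸ′ = subst (λ c′ → run P y g (child w c′) ≡ just c) (agree eq ins) rʸ
          in exit⇒run y S u e′ (trans (run-query y g eq) (subst (λ z → run P y g z ≡ just c) (child-query (y v) eq) rʸ′))

    same-exits⇒same-output : ∀ {g} → Computes P g → exit x S start ≡ exit y S start → g x ≡ g y
    same-exits⇒same-output {g} computes same =
      let f , r = run-transfer S start ≤-refl same (computes x)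
      in run-functional y {f} {S} {start} r (computes y)

  module Trace (nodes : List (Fin S))
    (covers : ∀ {w v j k} → kind w ≡ query v j k → inside v ≡ true → w ∈ nodes) where

    exitCode : (Fin m → Bool) → Fin S → Fin (suc S)
    exitCode x u = maybeToFin (exit x S u)

    childCodes : (Fin m → Bool) → Fin (length nodes) → Fin (suc S * suc S)
    childCodes x i = combine (exitCode x (child (List.lookup nodes i) false)) (exitCode x (child (List.lookup nodes i) true))

    trace : (Fin m → Bool) → Fin (suc S * (suc S * suc S) ^ length nodes)
    trace x = combine (exitCode x start) (funToFin (childCodes x))

    trace-cong-outside : ∀ {x y} → (∀ v → inside v ≡ false → x v ≡ y v) → trace x ≡ trace y
    trace-cong-outside {x} {y} x≈y =
      cong₂ combine (same start) (funToFin-cong {length nodes} λ i → cong₂ combine (same _) (same _))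
      where
      same : ∀ u → exitCode x u ≡ exitCode y u
      same u = cong maybeToFin (exit-cong-outside x≈y S u)

    trace-injective : ∀ {x y} → trace x ≡ trace y →
                      exitCode x start ≡ exitCode y start × (∀ i → childCodes x i ≡ childCodes y i)
    trace-injective {x} {y} eq =
      let start-eq , codes-eq = FP.combine-injective (exitCode x start) (funToFin (childCodes x))
                                                     (exitCode y start) (funToFin (childCodes y)) eq
      in start-eq , funToFin-injective codes-eq

    same-trace⇒same-output : ∀ {g x y} → Computes P g →
                             (∀ {w v j k} → kind w ≡ query v j k → inside v ≡ true → x v ≡ y v) →
                             trace x ≡ trace y → g x ≡ g y
    same-trace⇒same-output {x = x} {y} computes agree eq =
      same-exits⇒same-output agree exits-agree computes (maybeToFin-injective (proj₁ (trace-injective eq)))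
      where
      child-codes-agree : ∀ i → let w = List.lookup nodes i in
                          exitCode x (child w false) ≡ exitCode y (child w false) ×
                          exitCode x (child w true) ≡ exitCode y (child w true)
      child-codes-agree i = FP.combine-injective (exitCode x (child (List.lookup nodes i) false)) _ _ _
                              (proj₂ (trace-injective eq) i)
      child-exits-agree : ∀ i c → exit x S (child (List.lookup nodes i) c) ≡ exit y S (child (List.lookup nodes i) c)
      child-exits-agree i false = maybeToFin-injective (proj₁ (child-codes-agree i))
      child-exits-agree i true  = maybeToFin-injective (proj₂ (child-codes-agree i))
      exits-agree : ∀ {w v j k} → kind w ≡ query v j k → inside v ≡ true →
                    ∀ c → exit x S (child w c) ≡ exit y S (child w c)
      exits-agree q ins c = let w∈ = covers q ins in
        subst (λ u → exit x S (child u c) ≡ exit y S (child u c)) (sym (lookup-index w∈)) (child-exits-agree (index w∈) c)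

-- Hard inputs for OV on one block

inBlock : ∀ {n d} → Fin n → Fin (n * d) → Bool
inBlock {n} {d} i v = does (quotient {n} d v F.≟ i)

module _ {n d S : ℕ} (P : BP (n * d) S) where
  open BP P

  -- Sinks get the out-of-range tag n.
  queriedBlock : Fin S → ℕ
  queriedBlock u with kind u
  ... | leaf _      = n
  ... | query v _ _ = toℕ (quotient {n} d v)

  queriedBlock-query : ∀ {u v j k} → kind u ≡ query v j k → queriedBlock u ≡ toℕ (quotient {n} d v)
  queriedBlock-query {u} eq with kind u
  queriedBlock-query refl | _ = refl

  blockNodes : Fin n → List (Fin S)
  blockNodes i = filter (λ u → queriedBlock u ≟ toℕ i) (allFin S)

  blockNodes-covers : ∀ i {w v j k} → kind w ≡ query v j k → inBlock {n} {d} i v ≡ true → w ∈ blockNodes i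
  blockNodes-covers i {w} {v} eq ins with quotient {n} d v F.≟ i
  ... | yes v∈i = ∈-filter⁺ (λ u → queriedBlock u ≟ toℕ i) (∈-allFin w) (trans (queriedBlock-query eq) (cong toℕ v∈i))

module HardInstance {n d L w K : ℕ} (L<d : L < d) (w<L : w < L)
  (code : Fin K → Fin 2 → Vec Bool L)
  (weight-code : ∀ t c → weight (code t c) ≡ w)
  (code-injective : ∀ {t c t′ c′} → code t c ≡ code t′ c′ → t ≡ t′ × c ≡ c′)
  (i : Fin n) (σ : Fin n → Fin K) (σ-other : ∀ t → ∃ λ j → j ≢ i × σ j ≡ t) where

  -- Every bit T t is stored, as element (code t (T t)), in some block other than i.
  vectors : (Fin K → Fin 2) → (Fin d → Bool) → Fin n → Fin d → Bool
  vectors T b j with j F.≟ i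
  ... | yes _ = b
  ... | no _  = element (code (σ j) (T (σ j)))

  input : (Fin K → Fin 2) → (Fin d → Bool) → Fin (n * d) → Bool
  input T b = fromVectors (vectors T b)

  OV-input-hit : ∀ T t → OV n d (input T (complement (code t (T t)))) ≡ true
  OV-input-hit T t = let j , j≢i , σj≡t = σ-other t in OV-fromVectors≡true (vectors T _) i j (orthogonal j j≢i σj≡t)
    where
    orthogonal : ∀ j → j ≢ i → σ j ≡ t →
                 inner (vectors T (complement (code t (T t))) i) (vectors T (complement (code t (T t))) j) ≡ 0
    orthogonal j j≢i refl with i F.≟ i | j F.≟ i
    ... | yes _ | no _    = inner-complement-element≡0 {d = d} (code (σ j) (T (σ j)))
    ... | no i≢i | _      = contradiction refl i≢i
    ... | _      | yes j≡i = contradiction j≡i j≢i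

  OV-input-miss : ∀ T t c → T t ≢ c → OV n d (input T (complement (code t c))) ≡ false
  OV-input-miss T t c T≢c = OV-fromVectors≡false (vectors T (complement u)) non-orthogonal
    where
    u : Vec Bool L
    u = code t c
    u≢other : ∀ j → u ≢ code (σ j) (T (σ j))
    u≢other j eq = let t≡ , c≡ = code-injective eq in T≢c (trans (cong T t≡) (sym c≡))
    w≡ : ∀ j → weight u ≡ weight (code (σ j) (T (σ j)))
    w≡ j = trans (weight-code t c) (sym (weight-code _ _))
    non-orthogonal : ∀ p q → inner (vectors T (complement u) p) (vectors T (complement u) q) ≢ 0
    non-orthogonal p q with p F.≟ i | q F.≟ i
    ... | yes _ | yes _ = inner-complement-complement≢0 L<d u (subst (_< L) (sym (weight-code t c)) w<L)
    ... | yes _ | no _  = inner-complement-element≢0 L<d u _ (w≡ q) (u≢other q)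
    ... | no _  | yes _ = λ eq → inner-complement-element≢0 L<d u _ (w≡ p) (u≢other p) (trans (inner-comm {d} _ _) eq)
    ... | no _  | no _  = inner-element-element≢0 L<d _ _

  input-outside : ∀ T b b′ v → inBlock i v ≡ false → input T b v ≡ input T b′ v
  input-outside T b b′ v out with quotient {n} d v F.≟ i
  ... | no _ = refl

  input-inside : ∀ T T′ b v → inBlock i v ≡ true → input T b v ≡ input T′ b v
  input-inside T T′ b v ins with quotient {n} d v F.≟ i
  ... | yes _ = refl

  blank : Fin d → Bool
  blank _ = false

  module _ {S} (P : BP (n * d) S) (computes : Computes P (OV n d)) where
    open BP P using (kind)
    open Exits P (inBlock i)
    open Trace (blockNodes P i) (blockNodes-covers P i)

    private
      true≢false : true ≢ false
      true≢false ()

    distinct-traces : ∀ T T′ t → T t ≢ T′ t → trace (input T blank) ≢ trace (input T′ blank)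
    distinct-traces T T′ t T≢T′ eq = true≢false (begin
      true                    ≡⟨ OV-input-hit T t ⟨
      OV n d (input T b)      ≡⟨ same-trace⇒same-output computes (λ {_} {v} _ → input-inside T T′ b v) traces ⟩
      OV n d (input T′ b)     ≡⟨ OV-input-miss T′ t (T t) (T≢T′ ∘ sym) ⟩
      false                   ∎)
      where
      open ≡-Reasoning
      b : Fin d → Bool
      b = complement (code t (T t))
      traces : trace (input T b) ≡ trace (input T′ b)
      traces = trans (trace-cong-outside (λ v → input-outside T b blank v))
                     (trans eq (trace-cong-outside (λ v → input-outside T′ blank b v)))

    traceOf : Fin (2 ^ K) → Fin (suc S * (suc S * suc S) ^ length (blockNodes P i))
    traceOf a = trace (input (finToFun a) blank)

    traceOf-injective : ∀ {a a′} → traceOf a ≡ traceOf a′ → a ≡ a′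
    traceOf-injective {a} {a′} eq with FP.all? (λ t → finToFun a t F.≟ finToFun a′ t)
    ... | yes same = trans (sym (FP.funToFin-finToFin {K} a)) (trans (funToFin-cong same) (FP.funToFin-finToFin {K} a′))
    ... | no differ =
      let t , T≢T′ = FP.¬∀⟶∃¬ K _ (λ t → finToFun a t F.≟ finToFun a′ t) differ
      in contradiction eq (distinct-traces _ _ t T≢T′)

    blockNodes-nonempty : length (blockNodes P i) ≢ 0
    blockNodes-nonempty len≡0 = true≢false (begin
      true                 ≡⟨ OV-input-hit T t ⟨
      OV n d (input T b₀)  ≡⟨ same-trace⇒same-output computes no-inside-queries traces ⟩
      OV n d (input T b₁)  ≡⟨ OV-input-miss T t (F.suc F.zero) (λ ()) ⟩
      false                ∎)
      where
      open ≡-Reasoning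
      T : Fin K → Fin 2
      T _ = F.zero
      t : Fin K
      t = σ i
      b₀ b₁ : Fin d → Bool
      b₀ = complement (code t F.zero)
      b₁ = complement (code t (F.suc F.zero))
      traces : trace (input T b₀) ≡ trace (input T b₁)
      traces = trace-cong-outside (λ v → input-outside T b₀ b₁ v)
      no-inside-queries : ∀ {w v j k} → kind w ≡ query v j k → inBlock i v ≡ true → input T b₀ v ≡ input T b₁ v
      no-inside-queries q ins = contradiction (subst Fin len≡0 (index (blockNodes-covers P i q ins))) FP.¬Fin0

length-filter-∷ : ∀ {A : Set} {P : A → Set} (P? : Decidable P) x xs →
                  length (filter P? (x ∷ xs)) ≡ bit (does (P? x)) + length (filter P? xs)
length-filter-∷ P? x xs with does (P? x)
... | true  = refl
... | false = refl

sum-indicator≤1 : ∀ n x → ∑[ i < n ] (bit (does (x ≟ toℕ i))) ≤ 1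
sum-indicator≤1 zero    _       = z≤n
sum-indicator≤1 (suc n) zero    = s≤s (≤-reflexive (sum-replicate-zero n))
sum-indicator≤1 (suc n) (suc x) = sum-indicator≤1 n x

sum-length-filter≤length : ∀ {A : Set} n (tag : A → ℕ) xs →
                           ∑[ i < n ] (length (filter (λ x → tag x ≟ toℕ i) xs)) ≤ length xs
sum-length-filter≤length n tag []       = ≤-reflexive (sum-replicate-zero n)
sum-length-filter≤length {A} n tag (x ∷ xs) = begin
  ∑[ i < n ] (size i (x ∷ xs))                                   ≡⟨ sum-cong-≗ {n} (λ i → length-filter-∷ (λ y → tag y ≟ toℕ i) x xs) ⟩
  ∑[ i < n ] (bit (does (tag x ≟ toℕ i)) + size i xs)              ≡⟨ ∑-distrib-+ {n} _ _ ⟩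
  ∑[ i < n ] (bit (does (tag x ≟ toℕ i))) + ∑[ i < n ] (size i xs) ≤⟨ +-mono-≤ (sum-indicator≤1 n (tag x)) (sum-length-filter≤length n tag xs) ⟩
  suc (length xs)                                                  ∎
  where
  open ≤-Reasoning
  size : Fin n → List A → ℕ
  size i ys = length (filter (λ y → tag y ≟ toℕ i) ys)

∃-below-average : ∀ n (g : Fin (suc n) → ℕ) → ∃ λ i → suc n * g i ≤ sum g
∃-below-average zero    g = F.zero , ≤-reflexive (cong (g F.zero +_) (+-identityʳ 0))
∃-below-average (suc n) g with ∃-below-average n (g ∘ F.suc)
... | i , bound with g F.zero ≤? g (F.suc i)
...   | yes g₀≤gᵢ = F.zero , +-monoʳ-≤ (g F.zero) (≤-trans (*-monoʳ-≤ (suc n) g₀≤gᵢ) bound)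
...   | no  g₀≰gᵢ = F.suc i , +-mono-≤ (≤-trans (n≤1+n _) (≰⇒> g₀≰gᵢ)) bound

residue : ∀ {n} K .{{_ : NonZero K}} → Fin n → Fin K
residue K j = fromℕ< (m%n<n (toℕ j) K)

residue-other : ∀ {n K} .{{_ : NonZero K}} → K + K ≤ n → ∀ (i : Fin n) t → ∃ λ j → j ≢ i × residue K j ≡ t
residue-other {n} {K} 2K≤n i t = pick (j₁ F.≟ i)
  where
  K≤n : K ≤ n
  K≤n = ≤-trans (m≤m+n K K) 2K≤n
  j₁ j₂ : Fin n
  j₁ = inject≤ t K≤n
  j₂ = fromℕ< (≤-trans (+-monoˡ-≤ K (FP.toℕ<n t)) 2K≤n)
  toℕ-j₁ : toℕ j₁ ≡ toℕ t
  toℕ-j₁ = FP.toℕ-inject≤ t K≤n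
  toℕ-j₂ : toℕ j₂ ≡ toℕ t + K
  toℕ-j₂ = FP.toℕ-fromℕ< _
  t%K≡t : toℕ t % K ≡ toℕ t
  t%K≡t = m<n⇒m%n≡m (FP.toℕ<n t)
  residue-j₁ : residue K j₁ ≡ t
  residue-j₁ = FP.toℕ-injective (trans (FP.toℕ-fromℕ< _) (trans (cong (_% K) toℕ-j₁) t%K≡t))
  residue-j₂ : residue K j₂ ≡ t
  residue-j₂ = FP.toℕ-injective (trans (FP.toℕ-fromℕ< _) (trans (cong (_% K) toℕ-j₂) (trans ([m+n]%n≡m%n (toℕ t) K) t%K≡t)))
  j₂≢j₁ : j₂ ≢ j₁
  j₂≢j₁ eq = <⇒≢ (m<m+n (toℕ t) (>-nonZero⁻¹ K)) (sym (trans (sym toℕ-j₂) (trans (cong toℕ eq) toℕ-j₁)))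
  pick : Dec (j₁ ≡ i) → ∃ λ j → j ≢ i × residue K j ≡ t
  pick (no  j₁≢i) = j₁ , j₁≢i , residue-j₁
  pick (yes j₁≡i) = j₂ , (λ j₂≡i → j₂≢j₁ (trans j₂≡i (sym j₁≡i))) , residue-j₂

weightCode : ∀ L w {K} → K * 2 ≤ binomial L w → Fin K → Fin 2 → Vec Bool L
weightCode L w 2K≤M t c = ofWeight L w (inject≤ (combine t c) 2K≤M)

weight-weightCode : ∀ L w {K} (2K≤M : K * 2 ≤ binomial L w) t c → weight (weightCode L w {K} 2K≤M t c) ≡ w
weight-weightCode L w 2K≤M t c = weight-ofWeight L w (inject≤ (combine t c) 2K≤M)

weightCode-injective : ∀ L w {K} (2K≤M : K * 2 ≤ binomial L w) {t c t′ c′} →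
                       weightCode L w {K} 2K≤M t c ≡ weightCode L w 2K≤M t′ c′ → t ≡ t′ × c ≡ c′
weightCode-injective L w 2K≤M {t} {c} {t′} {c′} eq =
  FP.combine-injective t c t′ c′ (FP.inject≤-injective 2K≤M 2K≤M (combine t c) (combine t′ c′) (ofWeight-injective L w eq))

OV-block-bound : ∀ {n d S} (P : BP (n * d) S) → Computes P (OV n d) →
                 ∀ {L w K} → L < d → w < L → K * 2 ≤ binomial L w → K + K ≤ n → 0 < K →
                 ∃ λ s → 0 < s × n * s ≤ S × 2 ^ K ≤ suc S * (suc S * suc S) ^ s
OV-block-bound {zero} P _ _ _ _ 2K≤n (s≤s _) with () ← 2K≤n
OV-block-bound {suc n} {d} {S} P computes {L} {w} {K} L<d w<L 2K≤M 2K≤n K>0 =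
  let i , n*sᵢ≤∑s = ∃-below-average n size
      open Instance i
  in size i , n≢0⇒n>0 (blockNodes-nonempty P computes) ,
     ≤-trans n*sᵢ≤∑s ∑s≤S , FP.injective⇒≤ (traceOf-injective P computes)
  where
  instance
    K≢0 : NonZero K
    K≢0 = >-nonZero K>0
  size : Fin (suc n) → ℕ
  size i = length (blockNodes {suc n} {d} P i)
  ∑s≤S : ∑[ i < suc n ] size i ≤ S
  ∑s≤S = ≤-trans (sum-length-filter≤length (suc n) (queriedBlock {suc n} {d} P) (allFin S)) (≤-reflexive (LP.length-tabulate id))
  module Instance (i : Fin (suc n)) =
    HardInstance L<d w<L (weightCode L w {K} 2K≤M) (weight-weightCode L w {K} 2K≤M) (weightCode-injective L w {K} 2K≤M)
                 i (residue K) (residue-other 2K≤n i)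

-- Arithmetic

1≤⌈log₂n⌉ : ∀ {n} → 2 ≤ n → 1 ≤ ⌈log₂ n ⌉
1≤⌈log₂n⌉ {n} 2≤n = subst (_≤ ⌈log₂ n ⌉) (⌈log₂2^n⌉≡n 1) (⌈log₂⌉-mono-≤ 2≤n)

n≤2^⌈log₂n⌉ : ∀ n → n ≤ 2 ^ ⌈log₂ n ⌉
n≤2^⌈log₂n⌉ = <-rec (λ n → n ≤ 2 ^ ⌈log₂ n ⌉) step
  where
  step : ∀ n → (∀ {m} → m < n → m ≤ 2 ^ ⌈log₂ m ⌉) → n ≤ 2 ^ ⌈log₂ n ⌉
  step zero          _   = z≤n
  step (suc zero)    _   = s≤s z≤n
  step n@(suc (suc k)) rec = begin
    n                             ≡⟨ ⌊n/2⌋+⌈n/2⌉≡n n ⟨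
    ⌊ n /2⌋ + ⌈ n /2⌉             ≤⟨ +-monoˡ-≤ ⌈ n /2⌉ (⌊n/2⌋≤⌈n/2⌉ n) ⟩
    ⌈ n /2⌉ + ⌈ n /2⌉             ≤⟨ +-mono-≤ half≤ half≤ ⟩
    2 ^ (A ∸ 1) + 2 ^ (A ∸ 1)     ≡⟨ cong (2 ^ (A ∸ 1) +_) (+-identityʳ _) ⟨
    2 ^ suc (A ∸ 1)               ≡⟨ cong (2 ^_) (trans (+-comm 1 (A ∸ 1)) (m∸n+n≡m (1≤⌈log₂n⌉ {n} (s≤s (s≤s z≤n))))) ⟩
    2 ^ A                         ∎
    where
    open ≤-Reasoning
    A : ℕ
    A = ⌈log₂ n ⌉
    half≤ : ⌈ n /2⌉ ≤ 2 ^ (A ∸ 1)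
    half≤ = subst (λ e → ⌈ n /2⌉ ≤ 2 ^ e) (⌈log₂⌈n/2⌉⌉≡⌈log₂n⌉∸1 n) (rec (⌈n/2⌉<n k))

2^-cancel-≤ : ∀ {a b} → 2 ^ a ≤ 2 ^ b → a ≤ b
2^-cancel-≤ {a} {b} 2^a≤2^b with a ≤? b
... | yes a≤b = a≤b
... | no  a≰b = contradiction 2^a≤2^b (<⇒≱ (^-monoʳ-< 2 (s≤s (s≤s z≤n)) (≰⇒> a≰b)))

exponent-bound : ∀ {B a K s} → 0 < s → B ≤ 2 ^ a → 2 ^ K ≤ B * (B * B) ^ s → K ≤ 3 * a * s
exponent-bound {B} {a} {K} {s} 0<s B≤2^a count = begin
  K                       ≤⟨ 2^-cancel-≤ 2^K≤2^[a+2as] ⟩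
  a + (a + a) * s         ≤⟨ +-monoˡ-≤ ((a + a) * s) (m≤m*n a s {{>-nonZero 0<s}}) ⟩
  a * s + (a + a) * s     ≡⟨ collect a s ⟩
  3 * a * s               ∎
  where
  open ≤-Reasoning
  collect : ∀ a s → a * s + (a + a) * s ≡ 3 * a * s
  collect = solve-∀
  2^K≤2^[a+2as] : 2 ^ K ≤ 2 ^ (a + (a + a) * s)
  2^K≤2^[a+2as] = begin
    2 ^ K                             ≤⟨ count ⟩
    B * (B * B) ^ s                   ≤⟨ *-mono-≤ B≤2^a (^-monoˡ-≤ s (*-mono-≤ B≤2^a B≤2^a)) ⟩
    2 ^ a * (2 ^ a * 2 ^ a) ^ s       ≡⟨ cong (λ z → 2 ^ a * z ^ s) (^-distribˡ-+-* 2 a a) ⟨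
    2 ^ a * (2 ^ (a + a)) ^ s         ≡⟨ cong (2 ^ a *_) (^-*-assoc 2 (a + a) s) ⟩
    2 ^ a * 2 ^ ((a + a) * s)         ≡⟨ ^-distribˡ-+-* 2 a _ ⟨
    2 ^ (a + (a + a) * s)             ∎

halve : ∀ d → 1 ≤ d → ∃ λ m → suc (double m) ≤ d × d ≤ suc (suc (double m))
halve 1 _ = 0 , ≤-refl , s≤s z≤n
halve 2 _ = 0 , s≤s z≤n , ≤-refl
halve (suc (suc (suc d))) _ = let m , lo , hi = halve (suc d) (s≤s z≤n) in suc m , s≤s (s≤s lo) , s≤s (s≤s hi)

double⌊n/2⌋≤n : ∀ n → double ⌊ n /2⌋ ≤ n × n ≤ suc (double ⌊ n /2⌋)
double⌊n/2⌋≤n 0 = z≤n , z≤n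
double⌊n/2⌋≤n 1 = z≤n , s≤s z≤n
double⌊n/2⌋≤n (suc (suc n)) = let lo , hi = double⌊n/2⌋≤n n in s≤s (s≤s lo) , s≤s (s≤s hi)

double≡*2 : ∀ m → double m ≡ m * 2
double≡*2 zero    = refl
double≡*2 (suc m) = cong (suc ∘ suc) (double≡*2 m)

0<binomial : ∀ n k → k ≤ n → 0 < binomial n k
0<binomial n       zero    _         = s≤s z≤n
0<binomial (suc n) (suc k) (s≤s k≤n) = ≤-trans (0<binomial n k k≤n) (m≤m+n _ _)

m≤double : ∀ m → m ≤ double m
m≤double m = ≤-trans (m≤m+n m m) (≤-reflexive (sym (double≡+ m)))

2≤centralBinomial : ∀ m → 2 ≤ centralBinomial (suc m)
2≤centralBinomial m = +-mono-≤ (0<binomial _ m (≤-trans (m≤double m) (n≤1+n _))) (0<binomial _ (suc m) (s≤s (m≤double m)))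

4^d≤32d*centralBinomial² : ∀ {d} m → suc (double m) ≤ d → d ≤ suc (suc (double m)) →
                           2 ^ d * 2 ^ d ≤ 32 * d * (centralBinomial m * centralBinomial m)
4^d≤32d*centralBinomial² {d} m lo hi = begin
  2 ^ d * 2 ^ d                 ≡⟨ ^-distribˡ-+-* 2 d d ⟨
  2 ^ (d + d)                   ≤⟨ ^-monoʳ-≤ 2 (+-mono-≤ hi hi) ⟩
  2 ^ (D + D)                   ≡⟨ cong (2 ^_) (d≡ m) ⟩
  2 ^ (4 * suc m)               ≡⟨ ^-*-assoc 2 4 (suc m) ⟨
  16 * 16 ^ m                   ≤⟨ *-monoʳ-≤ 16 (16^m≤[4m+1]*centralBinomial² m) ⟩
  16 * ((4 * m + 1) * M²)       ≤⟨ coefficient ⟩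
  32 * d * M²                   ∎
  where
  open ≤-Reasoning
  M² D : ℕ
  M² = centralBinomial m * centralBinomial m
  D = suc (suc (double m))
  d≡ : ∀ m → suc (suc (double m)) + suc (suc (double m)) ≡ 4 * suc m
  d≡ m rewrite double≡+ m = solve′ m
    where
    solve′ : ∀ m → suc (suc (m + m)) + suc (suc (m + m)) ≡ 4 * suc m
    solve′ = solve-∀
  coefficient : 16 * ((4 * m + 1) * M²) ≤ 32 * d * M²
  coefficient = begin
    16 * ((4 * m + 1) * M²)       ≡⟨ *-assoc 16 (4 * m + 1) M² ⟨
    16 * (4 * m + 1) * M²         ≤⟨ *-monoˡ-≤ M² (m≤m+n (16 * (4 * m + 1)) 16) ⟩
    (16 * (4 * m + 1) + 16) * M²  ≡⟨ cong (_* M²) (trans (sixteens m) (cong (λ x → 32 * suc x) (sym (double≡+ m)))) ⟩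
    32 * suc (double m) * M²      ≤⟨ *-monoˡ-≤ M² (*-monoʳ-≤ 32 lo) ⟩
    32 * d * M²                   ∎
    where
    sixteens : ∀ m → 16 * (4 * m + 1) + 16 ≡ 32 * suc (m + m)
    sixteens = solve-∀

x^2≡x*x : ∀ x → x ^ 2 ≡ x * x
x^2≡x*x x = cong (x *_) (*-identityʳ x)

[x^2]^2≡[x*x]*[x*x] : ∀ x → (x ^ 2) ^ 2 ≡ (x * x) * (x * x)
[x^2]^2≡[x*x]*[x*x] x = trans (x^2≡x*x (x ^ 2)) (cong₂ _*_ (x^2≡x*x x) (x^2≡x*x x))

*-square-mono-≤ : ∀ {x y} → x ≤ y → x * x ≤ y * y
*-square-mono-≤ x≤y = *-mono-≤ x≤y x≤y

min≤32d*[n*[n⊓M]]² : ∀ {n d M} → 2 ^ d * 2 ^ d ≤ 32 * d * (M * M) →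
                     ((n ^ 2) ^ 2 * d) ⊓ ((n * 2 ^ d) ^ 2) ≤ 32 * d * ((n * (n ⊓ M)) * (n * (n ⊓ M)))
min≤32d*[n*[n⊓M]]² {n} {d} {M} 4^d≤ with ≤-total n M
... | inj₁ n≤M = begin
  ((n ^ 2) ^ 2 * d) ⊓ ((n * 2 ^ d) ^ 2)     ≤⟨ m⊓n≤m _ _ ⟩
  (n ^ 2) ^ 2 * d                          ≡⟨ trans (cong (_* d) ([x^2]^2≡[x*x]*[x*x] n)) (*-comm _ d) ⟩
  d * ((n * n) * (n * n))                  ≤⟨ *-monoˡ-≤ ((n * n) * (n * n)) (m≤n*m d 32) ⟩
  32 * d * ((n * n) * (n * n))             ≡⟨ cong (λ x → 32 * d * ((n * x) * (n * x))) (m≤n⇒m⊓n≡m n≤M) ⟨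
  32 * d * ((n * (n ⊓ M)) * (n * (n ⊓ M))) ∎
  where open ≤-Reasoning
... | inj₂ M≤n = begin
  ((n ^ 2) ^ 2 * d) ⊓ ((n * 2 ^ d) ^ 2)     ≤⟨ m⊓n≤n _ _ ⟩
  (n * 2 ^ d) ^ 2                          ≡⟨ split n (2 ^ d) ⟩
  (n * n) * (2 ^ d * 2 ^ d)                ≤⟨ *-monoʳ-≤ (n * n) 4^d≤ ⟩
  (n * n) * (32 * d * (M * M))             ≡⟨ regroup n d M ⟩
  32 * d * ((n * M) * (n * M))             ≡⟨ cong (λ x → 32 * d * ((n * x) * (n * x))) (m≥n⇒m⊓n≡n M≤n) ⟨
  32 * d * ((n * (n ⊓ M)) * (n * (n ⊓ M))) ∎
  where
  open ≤-Reasoning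
  split : ∀ n y → (n * y) ^ 2 ≡ (n * n) * (y * y)
  split n y = trans (x^2≡x*x (n * y)) (reorder n y)
    where
    reorder : ∀ n y → (n * y) * (n * y) ≡ (n * n) * (y * y)
    reorder = solve-∀
  regroup : ∀ n d M → (n * n) * (32 * d * (M * M)) ≡ 32 * d * ((n * M) * (n * M))
  regroup = solve-∀

OVBound : ℕ → ℕ → ℕ → Set
OVBound n d S = 1 ^ 2 * (((n ^ 2) ^ 2 * d) ⊓ ((n * 2 ^ d) ^ 2)) ≤ (144 * S * ⌈log₂ (n * d) ⌉ * ⌈log₂ d ⌉) ^ 2 * d

⌈log₂⌉-nonZero : ∀ {n} → 2 ≤ n → NonZero ⌈log₂ n ⌉
⌈log₂⌉-nonZero 2≤n = >-nonZero (1≤⌈log₂n⌉ 2≤n)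

2≤n*d : ∀ {n d} → 3 ≤ n → 3 ≤ d → 2 ≤ n * d
2≤n*d {n} {d} 3≤n 3≤d = *-mono-≤ {1} {n} {2} {d} (≤-trans (s≤s z≤n) 3≤n) (≤-trans (s≤s (s≤s z≤n)) 3≤d)

dense-bound : ∀ {n d S} → 3 ≤ n → 3 ≤ d → n * n ≤ S → OVBound n d S
dense-bound {n} {d} {S} 3≤n 3≤d n²≤S = begin
  1 * (((n ^ 2) ^ 2 * d) ⊓ ((n * 2 ^ d) ^ 2))  ≤⟨ *-monoʳ-≤ 1 (m⊓n≤m _ _) ⟩
  1 * ((n ^ 2) ^ 2 * d)                      ≡⟨ trans (*-identityˡ _) (cong (_* d) ([x^2]^2≡[x*x]*[x*x] n)) ⟩
  (n * n) * (n * n) * d                      ≤⟨ *-monoˡ-≤ d (*-square-mono-≤ (≤-trans n²≤S S≤144SAB)) ⟩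
  (144 * S * A * B) * (144 * S * A * B) * d  ≡⟨ cong (_* d) (x^2≡x*x (144 * S * A * B)) ⟨
  (144 * S * A * B) ^ 2 * d                  ∎
  where
  open ≤-Reasoning
  A B : ℕ
  A = ⌈log₂ (n * d) ⌉
  B = ⌈log₂ d ⌉
  S≤144SAB : S ≤ 144 * S * A * B
  S≤144SAB = ≤-trans (m≤n*m S 144) (≤-trans (m≤m*n (144 * S) A {{⌈log₂⌉-nonZero (2≤n*d 3≤n 3≤d)}})
                                             (m≤m*n (144 * S * A) B {{⌈log₂⌉-nonZero (≤-trans (s≤s (s≤s z≤n)) 3≤d)}}))

sparse-bound : ∀ {n d S M K s} → 3 ≤ n → 3 ≤ d → 2 ^ d * 2 ^ d ≤ 32 * d * (M * M) → n ⊓ M ≤ 3 * K →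
               0 < s → n * s ≤ S → 2 ^ K ≤ suc S * (suc S * suc S) ^ s → S < n * n → OVBound n d S
sparse-bound {n} {d} {S} {M} {K} {s} 3≤n 3≤d 4^d≤ x≤3K 0<s ns≤S count S<n² = begin
  1 * (((n ^ 2) ^ 2 * d) ⊓ ((n * 2 ^ d) ^ 2))  ≡⟨ *-identityˡ _ ⟩
  ((n ^ 2) ^ 2 * d) ⊓ ((n * 2 ^ d) ^ 2)      ≤⟨ min≤32d*[n*[n⊓M]]² {n} {d} {M} 4^d≤ ⟩
  32 * d * ((n * (n ⊓ M)) * (n * (n ⊓ M)))   ≤⟨ *-monoʳ-≤ (32 * d) (*-square-mono-≤ nx≤y) ⟩
  32 * d * (y * y)                           ≤⟨ *-mono-≤ (*-monoˡ-≤ d {32} {64} (m≤m+n 32 32))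
                                                         (*-square-mono-≤ (m≤m*n y B {{⌈log₂⌉-nonZero (≤-trans (s≤s (s≤s z≤n)) 3≤d)}})) ⟩
  64 * d * ((y * B) * (y * B))               ≡⟨ assemble d A S B ⟩
  (144 * S * A * B) * (144 * S * A * B) * d  ≡⟨ cong (_* d) (x^2≡x*x (144 * S * A * B)) ⟨
  (144 * S * A * B) ^ 2 * d                  ∎
  where
  open ≤-Reasoning
  A B y : ℕ
  A = ⌈log₂ (n * d) ⌉
  B = ⌈log₂ d ⌉
  y = 18 * A * S
  assemble : ∀ d A S B → 64 * d * ((18 * A * S * B) * (18 * A * S * B)) ≡ (144 * S * A * B) * (144 * S * A * B) * d
  assemble = solve-∀
  1+S≤2^[A+A] : suc S ≤ 2 ^ (A + A)
  1+S≤2^[A+A] = begin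
    suc S              ≤⟨ S<n² ⟩
    n * n              ≤⟨ *-square-mono-≤ (m≤m*n n d {{>-nonZero (≤-trans (s≤s z≤n) 3≤d)}}) ⟩
    (n * d) * (n * d)  ≤⟨ *-square-mono-≤ (n≤2^⌈log₂n⌉ (n * d)) ⟩
    2 ^ A * 2 ^ A      ≡⟨ ^-distribˡ-+-* 2 A A ⟨
    2 ^ (A + A)        ∎
  nx≤y : n * (n ⊓ M) ≤ y
  nx≤y = begin
    n * (n ⊓ M)                 ≤⟨ *-monoʳ-≤ n (≤-trans x≤3K (*-monoʳ-≤ 3 (exponent-bound {a = A + A} {K} 0<s 1+S≤2^[A+A] count))) ⟩
    n * (3 * (3 * (A + A) * s))  ≡⟨ regroup n A s ⟩
    18 * A * (n * s)            ≤⟨ *-monoʳ-≤ (18 * A) ns≤S ⟩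
    y                           ∎
    where
    regroup : ∀ n A s → n * (3 * (3 * (A + A) * s)) ≡ 18 * A * (n * s)
    regroup = solve-∀

halving-bounds : ∀ {x} → 2 ≤ x → 0 < ⌊ x /2⌋ × ⌊ x /2⌋ * 2 ≤ x × ⌊ x /2⌋ + ⌊ x /2⌋ ≤ x × x ≤ 3 * ⌊ x /2⌋
halving-bounds {x} 2≤x =
  0<K , subst (_≤ x) (double≡*2 K) 2K≤x , subst (_≤ x) (double≡+ K) 2K≤x ,
  ≤-trans x≤2K+1 (subst (suc (double K) ≤_) (triple K) (+-monoˡ-≤ (double K) 0<K))
  where
  K : ℕ
  K = ⌊ x /2⌋
  0<K : 0 < K
  0<K = ⌊n/2⌋-mono 2≤x
  2K≤x : double K ≤ x
  2K≤x = proj₁ (double⌊n/2⌋≤n x)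
  x≤2K+1 : x ≤ suc (double K)
  x≤2K+1 = proj₂ (double⌊n/2⌋≤n x)
  triple : ∀ K → K + double K ≡ 3 * K
  triple K rewrite double≡+ K = solve′ K
    where
    solve′ : ∀ K → K + (K + K) ≡ 3 * K
    solve′ = solve-∀

theorem1p2 : Σ ℕ λ p → Σ ℕ λ q → Σ ℕ λ N →
    ∀ (n d : ℕ) → N ≤ n → N ≤ d →
    ∀ (S : ℕ) (P : BP (n * d) S) → Computes P (OV n d) →
    (suc p ^ 2) * (((n ^ 2) ^ 2 * d) ⊓ ((n * 2 ^ d) ^ 2))
      ≤ (suc q * S * ⌈log₂ (n * d) ⌉ * ⌈log₂ d ⌉) ^ 2 * d
theorem1p2 = 0 , 143 , 3 , bound
  where
  bound : ∀ (n d : ℕ) → 3 ≤ n → 3 ≤ d → ∀ (S : ℕ) (P : BP (n * d) S) → Computes P (OV n d) → OVBound n d S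
  bound n d 3≤n 3≤d S P computes with halve d (≤-trans (s≤s z≤n) 3≤d)
  ... | zero  , _  , d≤2 = contradiction (≤-trans 3≤d d≤2) λ { (s≤s (s≤s ())) }
  ... | suc m , lo , hi =
    let M = centralBinomial (suc m)
        0<K , 2K≤x , K+K≤x , x≤3K = halving-bounds (⊓-glb (≤-trans (s≤s (s≤s z≤n)) 3≤n) (2≤centralBinomial m))
        s , 0<s , ns≤S , count = OV-block-bound P computes lo (s≤s (s≤s (m≤double m)))
                                   (≤-trans 2K≤x (m⊓n≤n n M)) (≤-trans K+K≤x (m⊓n≤m n M)) 0<K
    in case n * n ≤? S of λ where
         (yes n²≤S) → dense-bound 3≤n 3≤d n²≤S
         (no  n²≰S) → sparse-bound {K = ⌊ n ⊓ M /2⌋} 3≤n 3≤d (4^d≤32d*centralBinomial² (suc m) lo hi)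
                                    x≤3K 0<s ns≤S count (≰⇒> n²≰S)
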